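{- Let $\mathcal{B}$ be the class of all bipartite graphs. If $H$ is a shift graph, then $c^{\mathcal{B}}_{\mathrm l}(H)\le 2$.
   Context: All graphs are finite. For a directed graph $D$, the shift graph $\mathrm{shift}(D)$ is the undirected graph whose vertices are the edges of $D$, where two vertices $uv,xy\in E(D)$ are adjacent if and only if $v=x$. A shift graph is a graph of the form $\mathrm{shift}(D)$. For graphs $G,H$, a homomorphism $\varphi\colon G\to H$ is a map $V(G)\to V(H)$ with $\varphi(u)\varphi(v)\in E(H)$ whenever $uv\in E(G)$. $\dot\cup$ denotes vertex-disjoint union. For a graph class $\mathcal{G}$ and a graph $H$, a $\mathcal{G}$-cover of $H$ is an edge-surjective homomorphism $\varphi\colon G_1\dot\cup\cdots\dot\cup G_t\to H$ with all $G_i\in\mathcal{G}$; it is injective if each $\varphi|_{G_i}$ is injective, and $s$-local if $|\varphi^{ -1}(v)|\le s$ for all $v\in V(H)$. $c^{\mathcal{G}}_{\mathrm l}(H)$ is the least $s$ such that $H$ has an $s$-local injective $\mathcal{G}$-cover. -}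

module Defs where

open import Data.Nat using (ℕ)
open import Data.Fin using (Fin)
open import Data.Bool using (Bool)
open import Data.Product using (Σ; ∃; ∃-syntax; _×_; _,_)
open import Data.Sum using (_⊎_; inj₁; inj₂)
open import Relation.Binary.PropositionalEquality using (_≡_; _≢_; sym)
open import Relation.Nullary using (¬_)
open import Function.Bundles using (_↣_)
open import Function.Definitions using (Injective)

record Graph : Set₁ where
  field
    n      : ℕ
    _~_    : Fin n → Fin n → Set
    ~-sym  : ∀ {a b} → a ~ b → b ~ a
    ~-irr  : ∀ {a} → ¬ (a ~ a)
open Graph public

record Digraph : Set where
  field
    dn      : ℕ
    m       : ℕ
    tail    : Fin m → Fin dn
    head    : Fin m → Fin dn
    simple  : ∀ {e f} → tail e ≡ tail f → head e ≡ head f → e ≡ f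
    noLoop  : ∀ e → tail e ≢ head e
open Digraph public

-- shift(D): vertices are the arcs of D; uv and xy adjacent iff v = x
-- (read symmetrically, since the graph is undirected).
shift : Digraph → Graph
shift D = record
  { n     = m D
  ; _~_   = λ e f → (head D e ≡ tail D f) ⊎ (head D f ≡ tail D e)
  ; ~-sym = λ { (inj₁ p) → inj₂ p ; (inj₂ p) → inj₁ p }
  ; ~-irr = λ { {a} (inj₁ p) → noLoop D a (sym p) ; {a} (inj₂ p) → noLoop D a (sym p) }
  }

IsHom : (G H : Graph) → (Fin (n G) → Fin (n H)) → Set
IsHom G H φ = ∀ {a b} → _~_ G a b → _~_ H (φ a) (φ b)

Bipartite : Graph → Set
Bipartite G = Σ (Fin (n G) → Bool) λ c → ∀ {a b} → _~_ G a b → c a ≢ c b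

-- A 𝒢-cover of H: an edge-surjective homomorphism from G₁ ∪̇ … ∪̇ Gₜ to H,
-- given componentwise by φ i : V(G i) → V(H).
record Cover (𝒢 : Graph → Set) (H : Graph) : Set₁ where
  field
    t        : ℕ
    G        : Fin t → Graph
    inClass  : ∀ i → 𝒢 (G i)
    φ        : ∀ i → Fin (n (G i)) → Fin (n H)
    hom      : ∀ i → IsHom (G i) H (φ i)
    edgeSurj : ∀ {x y} → _~_ H x y →
               ∃[ i ] ∃[ a ] ∃[ b ] (_~_ (G i) a b × φ i a ≡ x × φ i b ≡ y)
open Cover public

IsInjectiveCover : ∀ {𝒢 H} → Cover 𝒢 H → Set
IsInjectiveCover C = ∀ i → Injective _≡_ _≡_ (φ C i)

Fiber : ∀ {𝒢 H} → Cover 𝒢 H → Fin (n H) → Set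
Fiber C v = Σ (Fin (t C)) λ i → Σ (Fin (n (G C i))) λ a → φ C i a ≡ v

-- s-local: |φ⁻¹(v)| ≤ s for all v (cardinality ≤ s as an injection into Fin s).
IsLocal : ∀ {𝒢 H} → ℕ → Cover 𝒢 H → Set
IsLocal s C = ∀ v → Fiber C v ↣ Fin s

-- H has an s-local injective 𝒢-cover; c^𝒢_l(H) ≤ s iff this holds
-- (s-local implies s'-local for s ≤ s').
HasLocalInjCover : (Graph → Set) → ℕ → Graph → Set₁
HasLocalInjCover 𝒢 s H = Σ (Cover 𝒢 H) λ C → IsInjectiveCover C × IsLocal s C

{-# OPTIONS --safe #-}
module Submission where

-- Cover shift(D) by the stars of D: for each vertex v of D, the arcs at v,
-- with an arc into v adjacent to an arc out of v. Every edge e f of shift(D)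
-- lies in the star of the common vertex, the star is bipartite (in-arcs
-- against out-arcs), and an arc lies only in the stars of its two endpoints.

open import Defs
open import Level using (0ℓ)
open import Data.Nat using (ℕ)
open import Data.Fin using (Fin; zero; suc; _≟_)
open import Data.Bool using (Bool; true; false)
open import Data.Product using (∃-syntax; _×_; _,_; proj₁; proj₂)
open import Data.Sum using (_⊎_; inj₁; inj₂)
open import Data.List using (List; filter; length; lookup; allFin)
import Data.List.Relation.Unary.All as All
open import Data.List.Relation.Unary.AllPairs using (_∷_)
open import Data.List.Relation.Unary.Unique.Propositional using (Unique)
open import Data.List.Relation.Unary.Unique.Propositional.Properties using (filter⁺; allFin⁺)
open import Data.List.Membership.Propositional.Properties using (∈-filter⁺; ∈-filter⁻; ∈-lookup; ∈-allFin)
open import Data.List.Relation.Unary.Any using (index)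
open import Data.List.Relation.Unary.Any.Properties using (lookup-index)
open import Relation.Binary.PropositionalEquality using (_≡_; _≢_; refl; sym; trans; cong; subst)
open import Relation.Nullary using (yes; no; contradiction)
open import Relation.Nullary.Decidable using (isYes; _⊎-dec_)
open import Relation.Unary using (Pred; Decidable)
open import Function.Bundles using (mk↣)
open import Function.Definitions using (Injective)

lookup-injective : ∀ {A : Set} {xs : List A} → Unique xs → Injective _≡_ _≡_ (lookup xs)
lookup-injective (_ ∷ _)    {zero}  {zero}  _  = refl
lookup-injective (x∉ ∷ _)   {zero}  {suc j} eq = contradiction eq (All.lookup x∉ (∈-lookup j))
lookup-injective (x∉ ∷ _)   {suc i} {zero}  eq = contradiction (sym eq) (All.lookup x∉ (∈-lookup i))
lookup-injective (_ ∷ uniq) {suc i} {suc j} eq = cong suc (lookup-injective uniq eq)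

record Enumeration {m : ℕ} (P : Pred (Fin m) 0ℓ) : Set where
  field
    size      : ℕ
    enum      : Fin size → Fin m
    injective : Injective _≡_ _≡_ enum
    sound     : ∀ i → P (enum i)
    complete  : ∀ {x} → P x → ∃[ i ] enum i ≡ x

enumerate : ∀ {m} {P : Pred (Fin m) 0ℓ} → Decidable P → Enumeration P
enumerate {m} P? = record
  { size      = length xs
  ; enum      = lookup xs
  ; injective = lookup-injective (filter⁺ P? (allFin⁺ m))
  ; sound     = λ i → proj₂ (∈-filter⁻ P? {xs = allFin m} (∈-lookup i))
  ; complete  = λ {x} px → let x∈xs = ∈-filter⁺ P? (∈-allFin x) px
                           in index x∈xs , sym (lookup-index x∈xs)
  }
  where xs = filter P? (allFin m)

module _ {𝒢 : Graph → Set} {H : Graph} (C : Cover 𝒢 H) where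

  fiber-component-injective : IsInjectiveCover C → ∀ {v} {x y : Fiber C v} →
                              proj₁ x ≡ proj₁ y → x ≡ y
  fiber-component-injective inj {x = i , a , refl} {y = .i , b , p} refl
    with inj i p
  ... | refl with p
  ...   | refl = refl

  -- An injective cover meets each component in at most one preimage of v,
  -- so it suffices to tell apart the components that v's preimage meets.
  injective-cover-local : ∀ {s} → IsInjectiveCover C →
    (code : Fin (n H) → Fin (t C) → Fin s) →
    (∀ {v} (x y : Fiber C v) → code v (proj₁ x) ≡ code v (proj₁ y) → proj₁ x ≡ proj₁ y) →
    IsLocal s C
  injective-cover-local inj code code-injective v =
    mk↣ λ {x} {y} eq → fiber-component-injective inj (code-injective x y eq)

module Star (D : Digraph) where

  Vertex : Set
  Vertex = Fin (dn D)

  Arc : Set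
  Arc = Fin (m D)

  IsEndpoint : Vertex → Pred Arc 0ℓ
  IsEndpoint v e = head D e ≡ v ⊎ tail D e ≡ v

  Through : Vertex → Arc → Arc → Set
  Through v e f = head D e ≡ v × tail D f ≡ v

  arcsAt : ∀ v → Enumeration (IsEndpoint v)
  arcsAt v = enumerate λ e → (head D e ≟ v) ⊎-dec (tail D e ≟ v)

  open Enumeration

  star : Vertex → Graph
  star v = record
    { n     = size (arcsAt v)
    ; _~_   = λ a b → Through v (ψ a) (ψ b) ⊎ Through v (ψ b) (ψ a)
    ; ~-sym = λ { (inj₁ t) → inj₂ t ; (inj₂ t) → inj₁ t }
    ; ~-irr = λ { {a} (inj₁ (h , t)) → noLoop D (ψ a) (trans t (sym h))
                ; {a} (inj₂ (h , t)) → noLoop D (ψ a) (trans t (sym h)) }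
    }
    where
    ψ : Fin (size (arcsAt v)) → Arc
    ψ = enum (arcsAt v)

  entersAt : Vertex → Arc → Bool
  entersAt v e = isYes (head D e ≟ v)

  through-entersAt : ∀ {v e f} → Through v e f → entersAt v e ≡ true × entersAt v f ≡ false
  through-entersAt {v} {e} {f} (he , tf) with head D e ≟ v | head D f ≟ v
  ... | yes _  | no _   = refl , refl
  ... | no ¬he | _      = contradiction he ¬he
  ... | yes _  | yes hf = contradiction (trans tf (sym hf)) (noLoop D f)

  star-bipartite : ∀ v → Bipartite (star v)
  star-bipartite v = (λ a → entersAt v (enum (arcsAt v) a)) , properly-coloured
    where
    separates : ∀ {e f} → Through v e f → entersAt v e ≢ entersAt v f
    separates t eq with through-entersAt t
    ... | e-in , f-out = contradiction (trans (sym e-in) (trans eq f-out)) λ ()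

    properly-coloured : ∀ {a b} → _~_ (star v) a b →
                        entersAt v (enum (arcsAt v) a) ≢ entersAt v (enum (arcsAt v) b)
    properly-coloured (inj₁ t) = separates t
    properly-coloured (inj₂ t) = λ eq → separates t (sym eq)

  star-hom : ∀ v → IsHom (star v) (shift D) (enum (arcsAt v))
  star-hom v (inj₁ (h , t)) = inj₁ (trans h (sym t))
  star-hom v (inj₂ (h , t)) = inj₂ (trans h (sym t))

  through-star : ∀ {v e f} → Through v e f →
    ∃[ a ] ∃[ b ] (_~_ (star v) a b × enum (arcsAt v) a ≡ e × enum (arcsAt v) b ≡ f)
  through-star {v} t@(he , tf) with complete (arcsAt v) (inj₁ he) | complete (arcsAt v) (inj₂ tf)
  ... | a , refl | b , refl = a , b , inj₁ t , refl , refl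

  star-edgeSurj : ∀ {e f} → _~_ (shift D) e f →
    ∃[ v ] ∃[ a ] ∃[ b ] (_~_ (star v) a b × enum (arcsAt v) a ≡ e × enum (arcsAt v) b ≡ f)
  star-edgeSurj {e} (inj₁ he≡tf) = head D e , through-star (refl , sym he≡tf)
  star-edgeSurj {f = f} (inj₂ hf≡te) with through-star (refl , sym hf≡te)
  ... | b , a , b~a , eb , ea = head D f , a , b , ~-sym (star (head D f)) b~a , ea , eb

  starCover : Cover Bipartite (shift D)
  starCover = record
    { t        = dn D
    ; G        = star
    ; inClass  = star-bipartite
    ; φ        = λ v → enum (arcsAt v)
    ; hom      = star-hom
    ; edgeSurj = star-edgeSurj
    }

  starCover-injective : IsInjectiveCover starCover
  starCover-injective v = injective (arcsAt v)

  endpointCode : Arc → Vertex → Fin 2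
  endpointCode e v with head D e ≟ v
  ... | yes _ = zero
  ... | no _  = suc zero

  endpointCode-injective : ∀ {e v w} → IsEndpoint v e → IsEndpoint w e →
                           endpointCode e v ≡ endpointCode e w → v ≡ w
  endpointCode-injective {e} {v} {w} ev ew eq with head D e ≟ v | head D e ≟ w
  endpointCode-injective _          _          _    | yes hv | yes hw = trans (sym hv) hw
  endpointCode-injective _          _          ()   | yes _  | no _
  endpointCode-injective _          _          ()   | no _   | yes _
  endpointCode-injective (inj₁ hv)  _          _    | no ¬hv | no _   = contradiction hv ¬hv
  endpointCode-injective _          (inj₁ hw)  _    | no _   | no ¬hw = contradiction hw ¬hw
  endpointCode-injective (inj₂ tv)  (inj₂ tw)  _    | no _   | no _   = trans (sym tv) tw

  starCover-local : IsLocal 2 starCover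
  starCover-local = injective-cover-local starCover starCover-injective endpointCode
    λ { (v , a , refl) (w , b , p) → endpointCode-injective (sound (arcsAt v) a)
                                       (subst (IsEndpoint w) p (sound (arcsAt w) b)) }

lemma19 : (D : Digraph) → HasLocalInjCover Bipartite 2 (shift D)
lemma19 D = starCover , starCover-injective , starCover-local
  where open Star D
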